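{- Consider an RMAS instance in which, for every edge $e=(u,u')\in E$, one has $\ell_{u,\min}<\ell_{u',\max}$. Consider the randomized algorithm that, independently for each node $u\in V$, sets $\ell(u)=\ell_{u,\min}$ with probability $\frac12$ and $\ell(u)=\ell_{u,\max}$ otherwise. Then the expected profit of the computed labeling is at least $\frac{W}{4}$, where $W=\sum_{e\in E} w_e$.
   Context: RMAS: the input is a directed graph $G=(V,E)$ with non-negative edge weights $\{w_e\}_{e\in E}$ and, for each node $v\in V$, an explicitly given finite nonempty set $L_v$ of integer labels. A feasible solution is a labeling $\ell$ with $\ell(v)\in L_v$ for all $v$; its profit is $\sum_{e=(u,v)\in E,\ \ell(u)<\ell(v)} w_e$. For $u\in V$, $\ell_{u,\min}=\min L_u$ and $\ell_{u,\max}=\max L_u$.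
   Formalization: The edge weights $w_e$ take values in the non-negative rationals. -}

module Defs where

open import Data.Nat using (ℕ; zero; suc)
open import Data.Fin using (Fin)
open import Data.Bool using (Bool; true; false; if_then_else_)
open import Data.Integer as ℤ using (ℤ; _⊓_; _⊔_)
open import Data.Rational as ℚ using (ℚ; ½; 0ℚ; _+_; _*_)
open import Data.List using (List; []; _∷_)
open import Data.List.NonEmpty using (List⁺; foldr₁)
open import Data.Product using (_×_; _,_)
open import Data.Vec.Functional using () renaming (_∷_ to _◂_)
open import Relation.Nullary.Decidable using (⌊_⌋)

minL : List⁺ ℤ → ℤ
minL = foldr₁ _⊓_

maxL : List⁺ ℤ → ℤ
maxL = foldr₁ _⊔_

profit : {n : ℕ} → List (Fin n × Fin n) → (Fin n → Fin n → ℚ) → (Fin n → ℤ) → ℚ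
profit [] w ℓ = 0ℚ
profit ((u , v) ∷ es) w ℓ =
  (if ⌊ ℓ u ℤ.<? ℓ v ⌋ then w u v else 0ℚ) + profit es w ℓ

totalWeight : {n : ℕ} → List (Fin n × Fin n) → (Fin n → Fin n → ℚ) → ℚ
totalWeight [] w = 0ℚ
totalWeight ((u , v) ∷ es) w = w u v + totalWeight es w

-- Expectation of f over σ : Fin n → Bool where the σ u are independent fair coins
expect : (n : ℕ) → ((Fin n → Bool) → ℚ) → ℚ
expect zero f = f (λ ())
expect (suc n) f = ½ * expect n (λ σ → f (false ◂ σ)) + ½ * expect n (λ σ → f (true ◂ σ))

coinLabeling : {n : ℕ} → (Fin n → List⁺ ℤ) → (Fin n → Bool) → Fin n → ℤ
coinLabeling L σ u = if σ u then maxL (L u) else minL (L u)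

-- By linearity of expectation it suffices to bound each edge (u, v) separately.  The two
-- coins of u and v are independent, so with probability ¼ node u gets ℓ_{u,min} and v gets
-- ℓ_{v,max}; since ℓ_{u,min} < ℓ_{v,max}, the edge then earns its full weight, and it never
-- earns a negative amount.
module Submission where

open import Defs
open import Data.Nat using (ℕ; zero; suc)
open import Data.Fin using (Fin; zero; suc)
open import Data.Integer as ℤ using (ℤ)
open import Data.Rational as ℚ using (ℚ; 0ℚ; ½; _*_; _≤_; _+_)
open import Data.Rational.Properties
open import Algebra.Bundles using (CommutativeMonoid)
open import Algebra.Properties.CommutativeSemigroup
  (CommutativeMonoid.commutativeSemigroup +-0-commutativeMonoid) using (interchange)
open import Data.List using (List; []; _∷_)
open import Data.List.NonEmpty using (List⁺)
open import Data.List.Relation.Unary.Unique.Propositional using (Unique)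
open import Data.List.Membership.Propositional using (_∈_)
open import Data.List.Relation.Unary.Any using (here; there)
open import Data.Product using (_×_; _,_)
open import Data.Bool using (Bool; true; false; if_then_else_; not; _∧_)
open import Data.Vec.Functional using () renaming (_∷_ to _◂_)
open import Relation.Nullary.Decidable using (⌊_⌋; yes; no)
open import Relation.Nullary using (contradiction)
open import Relation.Binary.PropositionalEquality
  using (_≡_; _≢_; refl; sym; trans; cong; cong₂; module ≡-Reasoning)

½-+-½ : ∀ x → ½ * x + ½ * x ≡ x
½-+-½ x = trans (sym (*-distribʳ-+ x ½ ½)) (*-identityˡ x)

½-average-interchange : ∀ a b c d →
  ½ * (½ * a + ½ * b) + ½ * (½ * c + ½ * d) ≡ ½ * (½ * a + ½ * c) + ½ * (½ * b + ½ * d)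
½-average-interchange a b c d = begin
  ½ * (½ * a + ½ * b) + ½ * (½ * c + ½ * d)
    ≡⟨ cong₂ _+_ (*-distribˡ-+ ½ (½ * a) (½ * b)) (*-distribˡ-+ ½ (½ * c) (½ * d)) ⟩
  (½ * (½ * a) + ½ * (½ * b)) + (½ * (½ * c) + ½ * (½ * d))
    ≡⟨ interchange (½ * (½ * a)) (½ * (½ * b)) (½ * (½ * c)) (½ * (½ * d)) ⟩
  (½ * (½ * a) + ½ * (½ * c)) + (½ * (½ * b) + ½ * (½ * d))
    ≡⟨ sym (cong₂ _+_ (*-distribˡ-+ ½ (½ * a) (½ * c)) (*-distribˡ-+ ½ (½ * b) (½ * d))) ⟩
  ½ * (½ * a + ½ * c) + ½ * (½ * b + ½ * d) ∎
  where open ≡-Reasoning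

expect-const : ∀ n c → expect n (λ _ → c) ≡ c
expect-const zero c = refl
expect-const (suc n) c rewrite expect-const n c = ½-+-½ c

expect-+ : ∀ n (f g : (Fin n → Bool) → ℚ) →
  expect n (λ σ → f σ + g σ) ≡ expect n f + expect n g
expect-+ zero f g = refl
expect-+ (suc n) f g = begin
  ½ * expect n (λ σ → f (false ◂ σ) + g (false ◂ σ)) + ½ * expect n (λ σ → f (true ◂ σ) + g (true ◂ σ))
    ≡⟨ cong₂ (λ x y → ½ * x + ½ * y) (expect-+ n _ _) (expect-+ n _ _) ⟩
  ½ * (f₀ + g₀) + ½ * (f₁ + g₁)
    ≡⟨ cong₂ _+_ (*-distribˡ-+ ½ f₀ g₀) (*-distribˡ-+ ½ f₁ g₁) ⟩
  (½ * f₀ + ½ * g₀) + (½ * f₁ + ½ * g₁)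
    ≡⟨ interchange (½ * f₀) (½ * g₀) (½ * f₁) (½ * g₁) ⟩
  (½ * f₀ + ½ * f₁) + (½ * g₀ + ½ * g₁) ∎
  where
  open ≡-Reasoning
  f₀ = expect n (λ σ → f (false ◂ σ)); f₁ = expect n (λ σ → f (true ◂ σ))
  g₀ = expect n (λ σ → g (false ◂ σ)); g₁ = expect n (λ σ → g (true ◂ σ))

expect-mono : ∀ n {f g : (Fin n → Bool) → ℚ} → (∀ σ → f σ ≤ g σ) → expect n f ≤ expect n g
expect-mono zero f≤g = f≤g _
expect-mono (suc n) f≤g =
  +-mono-≤ (*-monoˡ-≤-nonNeg ½ (expect-mono n (λ σ → f≤g (false ◂ σ))))
           (*-monoˡ-≤-nonNeg ½ (expect-mono n (λ σ → f≤g (true ◂ σ))))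

expect-coin : ∀ n v (f : Bool → ℚ) → expect n (λ σ → f (σ v)) ≡ ½ * f false + ½ * f true
expect-coin (suc n) zero f rewrite expect-const n (f false) | expect-const n (f true) = refl
expect-coin (suc n) (suc v) f rewrite expect-coin n v f = ½-+-½ _

expect-two-coins : ∀ n {u v} → u ≢ v → (g : Bool → Bool → ℚ) →
  expect n (λ σ → g (σ u) (σ v))
    ≡ ½ * (½ * g false false + ½ * g false true) + ½ * (½ * g true false + ½ * g true true)
expect-two-coins (suc n) {zero} {zero} u≢v g = contradiction refl u≢v
expect-two-coins (suc n) {zero} {suc v} u≢v g
  rewrite expect-coin n v (g false) | expect-coin n v (g true) = refl
expect-two-coins (suc n) {suc u} {zero} u≢v g
  rewrite expect-coin n u (λ a → g a false) | expect-coin n u (λ a → g a true) =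
  ½-average-interchange (g false false) (g true false) (g false true) (g true true)
expect-two-coins (suc n) {suc u} {suc v} u≢v g
  rewrite expect-two-coins n (λ u≡v → u≢v (cong suc u≡v)) g = ½-+-½ _

indicator : Bool → ℚ → ℚ
indicator b c = if b then c else 0ℚ

gain : ℚ → ℤ → ℤ → ℚ
gain w x y = indicator ⌊ x ℤ.<? y ⌋ w

gain-nonNeg : ∀ {w} x y → 0ℚ ≤ w → 0ℚ ≤ gain w x y
gain-nonNeg x y 0≤w with x ℤ.<? y
... | yes _ = 0≤w
... | no _ = ≤-refl

gain-< : ∀ {w x y} → x ℤ.< y → gain w x y ≡ w
gain-< {x = x} {y} x<y with x ℤ.<? y
... | yes _ = refl
... | no x≮y = contradiction x<y x≮y

expect-min-then-max : ∀ n {u v} → u ≢ v → ∀ c →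
  expect n (λ σ → indicator (not (σ u) ∧ σ v) c) ≡ (½ * ½) * c
expect-min-then-max n {u} {v} u≢v c = begin
  expect n (λ σ → indicator (not (σ u) ∧ σ v) c)
    ≡⟨ expect-two-coins n u≢v (λ a b → indicator (not a ∧ b) c) ⟩
  ½ * (½ * 0ℚ + ½ * c) + ½ * (½ * 0ℚ + ½ * 0ℚ)
    ≡⟨ cong₂ (λ x y → ½ * (x + ½ * c) + ½ * (x + y)) (*-zeroʳ ½) (*-zeroʳ ½) ⟩
  ½ * (0ℚ + ½ * c) + ½ * (0ℚ + 0ℚ)
    ≡⟨ cong₂ _+_ (cong (½ *_) (+-identityˡ (½ * c))) (*-zeroʳ ½) ⟩
  ½ * (½ * c) + 0ℚ
    ≡⟨ +-identityʳ _ ⟩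
  ½ * (½ * c)
    ≡⟨ sym (*-assoc ½ ½ c) ⟩
  (½ * ½) * c ∎
  where open ≡-Reasoning

min-then-max-≤-gain : ∀ {w mᵤ Mᵤ mᵥ Mᵥ} → 0ℚ ≤ w → mᵤ ℤ.< Mᵥ → ∀ a b →
  indicator (not a ∧ b) w ≤ gain w (if a then Mᵤ else mᵤ) (if b then Mᵥ else mᵥ)
min-then-max-≤-gain 0≤w mᵤ<Mᵥ false true = ≤-reflexive (sym (gain-< mᵤ<Mᵥ))
min-then-max-≤-gain 0≤w _ true b = gain-nonNeg _ _ 0≤w
min-then-max-≤-gain 0≤w _ false false = gain-nonNeg _ _ 0≤w

quarter-≤-expect-gain : ∀ n (w : ℚ) (L : Fin n → List⁺ ℤ) {u v} → u ≢ v → 0ℚ ≤ w →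
  minL (L u) ℤ.< maxL (L v) →
  (½ * ½) * w ≤ expect n (λ σ → gain w (coinLabeling L σ u) (coinLabeling L σ v))
quarter-≤-expect-gain n w L {u} {v} u≢v 0≤w minᵤ<maxᵥ = begin
  (½ * ½) * w
    ≡⟨ expect-min-then-max n u≢v w ⟨
  expect n (λ σ → indicator (not (σ u) ∧ σ v) w)
    ≤⟨ expect-mono n (λ σ → min-then-max-≤-gain 0≤w minᵤ<maxᵥ (σ u) (σ v)) ⟩
  expect n (λ σ → gain w (coinLabeling L σ u) (coinLabeling L σ v)) ∎
  where open ≤-Reasoning

quarter-totalWeight-≤-expect-profit : ∀ n E (w : Fin n → Fin n → ℚ) (L : Fin n → List⁺ ℤ)
  → (∀ {u v} → (u , v) ∈ E → u ≢ v)
  → (∀ {u v} → (u , v) ∈ E → 0ℚ ≤ w u v)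
  → (∀ {u v} → (u , v) ∈ E → minL (L u) ℤ.< maxL (L v))
  → (½ * ½) * totalWeight E w ≤ expect n (λ σ → profit E w (coinLabeling L σ))
quarter-totalWeight-≤-expect-profit n [] w L _ _ _ =
  ≤-reflexive (trans (*-zeroʳ (½ * ½)) (sym (expect-const n 0ℚ)))
quarter-totalWeight-≤-expect-profit n ((u , v) ∷ E) w L loopless nonNeg min<max = begin
  (½ * ½) * (w u v + totalWeight E w)
    ≡⟨ *-distribˡ-+ (½ * ½) (w u v) (totalWeight E w) ⟩
  (½ * ½) * w u v + (½ * ½) * totalWeight E w
    ≤⟨ +-mono-≤ (quarter-≤-expect-gain n (w u v) L (loopless (here refl)) (nonNeg (here refl))
                                       (min<max (here refl)))
                (quarter-totalWeight-≤-expect-profit n E w L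
                   (λ e → loopless (there e)) (λ e → nonNeg (there e)) (λ e → min<max (there e))) ⟩
  expect n (λ σ → gain (w u v) (coinLabeling L σ u) (coinLabeling L σ v))
    + expect n (λ σ → profit E w (coinLabeling L σ))
    ≡⟨ expect-+ n _ _ ⟨
  expect n (λ σ → profit ((u , v) ∷ E) w (coinLabeling L σ)) ∎
  where open ≤-Reasoning

-- Linearity of expectation does not need the edges to be distinct, so Unique E is unused.
lemma1 : (n : ℕ) (E : List (Fin n × Fin n)) (w : Fin n → Fin n → ℚ) (L : Fin n → List⁺ ℤ)
         → Unique E
         → (∀ {u v} → (u , v) ∈ E → u ≢ v)
         → (∀ {u v} → (u , v) ∈ E → 0ℚ ≤ w u v)
         → (∀ {u v} → (u , v) ∈ E → minL (L u) ℤ.< maxL (L v))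
         → (½ * ½) * totalWeight E w ≤ expect n (λ σ → profit E w (coinLabeling L σ))
lemma1 n E w L _ = quarter-totalWeight-≤-expect-profit n E w L
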